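{- There is an absolute constant $C$ such that for every connected $3$-colorable graph $G$ of order $n$ and minimum degree at least $\delta\ge 1$, \[ \operatorname{diam}(G)\le \frac{5n}{2\delta}+C. \]
   Context: $\operatorname{diam}(G)$ is the diameter of $G$. The paper writes the additive term as $O(1)$. -}

module Defs where

open import Data.Nat using (ℕ; zero; suc; _+_; _*_; _≤_)
open import Data.Fin using (Fin)
open import Data.Product using (Σ; ∃; _×_)
open import Relation.Binary.PropositionalEquality using (_≡_)
open import Relation.Nullary using (¬_)
open import Level using (0ℓ)

record Graph (n : ℕ) : Set₁ where
  field
    Adj     : Fin n → Fin n → Set
    sym     : ∀ {u v} → Adj u v → Adj v u
    irrefl  : ∀ {u} → ¬ Adj u u
open Graph public

data Walk {n : ℕ} (G : Graph n) : Fin n → Fin n → ℕ → Set where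
  here : ∀ {u} → Walk G u u zero
  step : ∀ {u v w k} → Adj G u v → Walk G v w k → Walk G u w (suc k)

Connected : ∀ {n} → Graph n → Set
Connected G = ∀ u v → ∃ λ k → Walk G u v k

DistLe : ∀ {n} → Graph n → Fin n → Fin n → ℕ → Set
DistLe G u v d = ∃ λ k → k ≤ d × Walk G u v k

DiamLe : ∀ {n} → Graph n → ℕ → Set
DiamLe G d = ∀ u v → DistLe G u v d

DegGe : ∀ {n} → Graph n → Fin n → ℕ → Set
DegGe {n} G v δ =
  Σ (Fin δ → Fin n) λ f →
    (∀ i j → f i ≡ f j → i ≡ j) × (∀ i → Adj G v (f i))

MinDegGe : ∀ {n} → Graph n → ℕ → Set
MinDegGe G δ = ∀ v → DegGe G v δ

ThreeColorable : ∀ {n} → Graph n → Set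
ThreeColorable {n} G =
  Σ (Fin n → Fin 3) λ c → ∀ {u v} → Adj G u v → ¬ (c u ≡ c v)

-- Fix a root r and split the vertices into breadth-first layers L₀, …, L_D by distance from r. A
-- vertex x ∈ L_j has at least δ neighbours, all in L_{j-1} ∪ L_j ∪ L_{j+1} and coloured differently
-- from x. Each layer j places two tokens on colours occurring in L_j; a token of colour c picks a
-- vertex of colour c in L_j and charges one unit to each of its δ neighbours, so layer j charges at
-- least 2δ and the total charge is at least (D + 1)·2δ. A vertex y ∈ L_k is charged only by tokens
-- of layers k - 1, k, k + 1 of a colour other than col y, at most 2 per layer. With three colours
-- the tokens can be chosen so that col y always carries a token of layer k or of layer k - 1 (when a
-- layer shows all three colours, omit one carried by a token of the previous layer), which saves a
-- unit: every vertex is charged at most 5. Hence (D + 1)·2δ ≤ 5n, and taking r = u bounds dist(u, v).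
module Submission where

open import Defs hiding (sym)
open import Data.Nat using (ℕ; suc; _+_; _*_; _≤_)
open import Data.Product using (Σ; _×_)

open import Data.Nat.Properties using (+-*-semiring)
open import Algebra.Properties.Semiring.Sum +-*-semiring
  using (sum; sum-syntax; sum-remove; sum-cong-≗; sum-replicate-zero; ∑-distrib-+; ∑-comm)
open import Data.Bool using (if_then_else_)
open import Data.Empty using (⊥; ⊥-elim)
open import Data.Fin using (Fin; zero; suc; toℕ; punchIn; punchOut)
open import Data.Fin.Patterns using (0F; 1F; 2F)
open import Data.Fin.Properties as Fin using (any?; all?; punchIn-punchOut; punchOut-injective; toℕ<n)
open import Data.Fin.Subset using (Subset; inside; outside; _∈_; Nonempty)
open import Data.Fin.Subset.Properties using (anySubset?; _∈?_; nonempty?)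
open import Data.Nat using (zero; _∸_; _<_; z≤n; _/_; NonZero; _≤′_; ≤′-refl; ≤′-step)
open import Data.Nat.DivMod using (m/n*n≤m; m*n/n≡m; /-monoˡ-≤)
open import Data.Nat.Properties
  using ( _≟_; ≤-refl; ≤-trans; ≤-reflexive; ≤-antisym; ≤-pred; ≰⇒>; ≤⇒≤′; n≤0⇒n≡0
        ; <-cmp; <-irrefl; ≤∧≢⇒<; m≤m+n; m≤n+m; +-mono-≤; *-mono-≤; +-identityʳ; *-comm
        ; *-distribˡ-+; *-distribʳ-+; +-suc; module ≤-Reasoning)
open import Data.Product using (∃; _,_; proj₁; proj₂)
open import Data.Sum using (_⊎_; inj₁; inj₂; swap; map₁)
open import Data.Vec using ([]; _∷_; tabulate)
open import Data.Vec.Properties using (lookup∘tabulate; lookup⇒[]=; []=⇒lookup)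
open import Function using (_∘_; Injective; case_of_)
open import Relation.Binary using (Decidable; tri<; tri≈; tri>)
open import Relation.Binary.PropositionalEquality
  using (_≡_; _≢_; refl; sym; trans; cong; cong₂; subst)
open import Relation.Nullary using (Dec; does; yes; no; ¬_; ¬?)
open import Relation.Nullary.Decidable
  using (map′; decidable-stable; toWitness; dec-true; dec-false; _×-dec_; _⊎-dec_; _→-dec_)

⟦_⟧ : ∀ {A : Set} → Dec A → ℕ
⟦ a? ⟧ = if does a? then 1 else 0

⟦⟧-yes : ∀ {A : Set} (a? : Dec A) → A → ⟦ a? ⟧ ≡ 1
⟦⟧-yes a? a rewrite dec-true a? a = refl

⟦⟧-no : ∀ {A : Set} (a? : Dec A) → ¬ A → ⟦ a? ⟧ ≡ 0
⟦⟧-no a? ¬a rewrite dec-false a? ¬a = refl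

⟦⟧≤1 : ∀ {A : Set} (a? : Dec A) → ⟦ a? ⟧ ≤ 1
⟦⟧≤1 (yes _) = ≤-refl
⟦⟧≤1 (no _)  = z≤n

∑-mono-≤ : ∀ {n} {f g : Fin n → ℕ} → (∀ i → f i ≤ g i) → ∑[ i < n ] f i ≤ ∑[ i < n ] g i
∑-mono-≤ {zero}  f≤g = z≤n
∑-mono-≤ {suc n} f≤g = +-mono-≤ (f≤g zero) (∑-mono-≤ (f≤g ∘ suc))

∑-const : ∀ n c → ∑[ i < n ] c ≡ n * c
∑-const zero    c = refl
∑-const (suc n) c = cong (c +_) (∑-const n c)

∑-injection : ∀ {m n} (χ : Fin n → ℕ) (f : Fin m → Fin n) → Injective _≡_ _≡_ f →
              (∀ i → 1 ≤ χ (f i)) → m ≤ sum χ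
∑-injection {zero}          χ f f-inj χ∘f≥1 = z≤n
∑-injection {suc m} {zero}  χ f           = case f zero of λ ()
∑-injection {suc m} {suc n} χ f f-inj χ∘f≥1 = begin
  1 + m                               ≤⟨ +-mono-≤ (χ∘f≥1 zero) (∑-injection _ f′ f′-inj χ∘f′≥1) ⟩
  χ f₀ + ∑[ i < n ] χ (punchIn f₀ i)  ≡⟨ sym (sum-remove χ) ⟩
  sum χ                               ∎
  where
  open ≤-Reasoning
  f₀ = f zero
  f₀≢f : ∀ i → f₀ ≢ f (suc i)
  f₀≢f i = Fin.0≢1+n ∘ f-inj
  f′ : Fin m → Fin n
  f′ i = punchOut (f₀≢f i)
  f′-inj : Injective _≡_ _≡_ f′
  f′-inj = Fin.suc-injective ∘ f-inj ∘ punchOut-injective (f₀≢f _) (f₀≢f _)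
  χ∘f′≥1 : ∀ i → 1 ≤ χ (punchIn f₀ (f′ i))
  χ∘f′≥1 i rewrite punchIn-punchOut (f₀≢f i) = χ∘f≥1 (suc i)

∑-indicator : ∀ N a (u : ℕ → ℕ) → ∑[ j < N ] (⟦ toℕ j ≟ a ⟧ * u (toℕ j)) ≤ u a
∑-indicator zero    a       u = z≤n
∑-indicator (suc N) zero    u =
  ≤-reflexive (trans (cong₂ _+_ (+-identityʳ (u 0)) (sum-replicate-zero N)) (+-identityʳ (u 0)))
∑-indicator (suc N) (suc a) u = ∑-indicator N a (u ∘ suc)

-- near j k is positive iff |j - k| ≤ 1; since 0 ∸ 1 = 0, the term j = 0 is counted twice when k = 0.
module NearTerms (j k : ℕ) where
  below at above : ℕ
  below = ⟦ j ≟ k ∸ 1 ⟧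
  at    = ⟦ j ≟ k ⟧
  above = ⟦ j ≟ suc k ⟧

near : ℕ → ℕ → ℕ
near j k = below + at + above
  where open NearTerms j k

near-positive : ∀ {j k} → k ≤ suc j → j ≤ suc k → 1 ≤ near j k
near-positive {j} {k} k≤1+j j≤1+k with <-cmp j k
... | tri< j<k _ _ = begin
  1                  ≡⟨ sym (⟦⟧-yes (j ≟ k ∸ 1) (cong (_∸ 1) (≤-antisym j<k k≤1+j))) ⟩
  below              ≤⟨ ≤-trans (m≤m+n below at) (m≤m+n (below + at) above) ⟩
  below + at + above ∎
  where open ≤-Reasoning; open NearTerms j k
... | tri≈ _ j≡k _ = begin
  1                  ≡⟨ sym (⟦⟧-yes (j ≟ k) j≡k) ⟩
  at                 ≤⟨ ≤-trans (m≤n+m at below) (m≤m+n (below + at) above) ⟩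
  below + at + above ∎
  where open ≤-Reasoning; open NearTerms j k
... | tri> _ _ k<j = begin
  1                  ≡⟨ sym (⟦⟧-yes (j ≟ suc k) (sym (≤-antisym k<j j≤1+k))) ⟩
  above              ≤⟨ m≤n+m above (below + at) ⟩
  below + at + above ∎
  where open ≤-Reasoning; open NearTerms j k

∑-near : ∀ N k (u : ℕ → ℕ) →
         ∑[ j < N ] (near (toℕ j) k * u (toℕ j)) ≤ u (k ∸ 1) + u k + u (suc k)
∑-near N k u = begin
  ∑[ j < N ] (near (toℕ j) k * u (toℕ j))
    ≡⟨ sum-cong-≗ {N} {λ j → near (toℕ j) k * u (toℕ j)} {λ j → A (toℕ j) + B (toℕ j) + C (toℕ j)}
         (split ∘ toℕ) ⟩
  ∑[ j < N ] (A (toℕ j) + B (toℕ j) + C (toℕ j))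
    ≡⟨ ∑-distrib-+ {N} (λ j → A (toℕ j) + B (toℕ j)) (C ∘ toℕ) ⟩
  ∑[ j < N ] (A (toℕ j) + B (toℕ j)) + ∑[ j < N ] C (toℕ j)
    ≡⟨ cong (_+ ∑[ j < N ] C (toℕ j)) (∑-distrib-+ {N} (A ∘ toℕ) (B ∘ toℕ)) ⟩
  ∑[ j < N ] A (toℕ j) + ∑[ j < N ] B (toℕ j) + ∑[ j < N ] C (toℕ j)
    ≤⟨ +-mono-≤ (+-mono-≤ (∑-indicator N (k ∸ 1) u) (∑-indicator N k u))
                (∑-indicator N (suc k) u) ⟩
  u (k ∸ 1) + u k + u (suc k)
    ∎
  where
  open ≤-Reasoning
  A B C : ℕ → ℕ
  A j = ⟦ j ≟ k ∸ 1 ⟧ * u j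
  B j = ⟦ j ≟ k ⟧ * u j
  C j = ⟦ j ≟ suc k ⟧ * u j
  split : ∀ j → near j k * u j ≡ A j + B j + C j
  split j = trans (*-distribʳ-+ (u j) (⟦ j ≟ k ∸ 1 ⟧ + ⟦ j ≟ k ⟧) ⟦ j ≟ suc k ⟧)
                  (cong (_+ C j) (*-distribʳ-+ (u j) ⟦ j ≟ k ∸ 1 ⟧ ⟦ j ≟ k ⟧))

∀-subset? : ∀ {n} {P : Subset n → Set} → (∀ p → Dec (P p)) → Dec (∀ p → P p)
∀-subset? P? = map′ (λ ¬∃¬ p → decidable-stable (P? p) (¬∃¬ ∘ (p ,_)))
                    (λ ∀P (p , ¬Pp) → ¬Pp (∀P p))
                    (¬? (anySubset? (¬? ∘ P?)))

Carries : ∀ {m} → Fin m × Fin m → Fin m → Set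
Carries (a , b) c = c ≡ a ⊎ c ≡ b

others : Fin 3 → Fin 3 × Fin 3
others 0F = 1F , 2F
others 1F = 0F , 2F
others 2F = 0F , 1F

-- The token colours of a layer with colour set p, where a is a token colour of the previous layer.
-- The first clause is junk: a layer without colours has no vertices to charge.
next : Fin 3 → Subset 3 → Fin 3 × Fin 3
next a (outside ∷ outside ∷ outside ∷ []) = a , a
next a (inside  ∷ outside ∷ outside ∷ []) = 0F , 0F
next a (outside ∷ inside  ∷ outside ∷ []) = 1F , 1F
next a (outside ∷ outside ∷ inside  ∷ []) = 2F , 2F
next a (inside  ∷ inside  ∷ outside ∷ []) = 0F , 1F
next a (inside  ∷ outside ∷ inside  ∷ []) = 0F , 2F
next a (outside ∷ inside  ∷ inside  ∷ []) = 1F , 2F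
next a (inside  ∷ inside  ∷ inside  ∷ []) = others a

next-⊆ : ∀ a p → Nonempty p → proj₁ (next a p) ∈ p × proj₂ (next a p) ∈ p
next-⊆ = toWitness {a? = all? λ a → ∀-subset? λ p →
  nonempty? p →-dec (proj₁ (next a p) ∈? p ×-dec proj₂ (next a p) ∈? p)} _

next-covers : ∀ a p c → c ∈ p → c ≡ a ⊎ Carries (next a p) c
next-covers = toWitness {a? = all? λ a → ∀-subset? λ p → all? λ c →
  c ∈? p →-dec (c Fin.≟ a ⊎-dec (c Fin.≟ proj₁ (next a p) ⊎-dec c Fin.≟ proj₂ (next a p)))} _

differ : ∀ {m} → Fin m → Fin m → ℕ
differ a c = ⟦ ¬? (a Fin.≟ c) ⟧

differ-≤1 : ∀ {m} (a c : Fin m) → differ a c ≤ 1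
differ-≤1 a c = ⟦⟧≤1 (¬? (a Fin.≟ c))

differ-self : ∀ {m} (a : Fin m) → differ a a ≡ 0
differ-self a = ⟦⟧-no (¬? (a Fin.≟ a)) (λ a≢a → a≢a refl)

differ-≢ : ∀ {m} {a c : Fin m} → a ≢ c → differ a c ≡ 1
differ-≢ {a = a} {c} a≢c = ⟦⟧-yes (¬? (a Fin.≟ c)) a≢c

misses : ∀ {m} → Fin m × Fin m → Fin m → ℕ
misses (a , b) c = differ a c + differ b c

misses-≤2 : ∀ {m} (t : Fin m × Fin m) c → misses t c ≤ 2
misses-≤2 (a , b) c = +-mono-≤ (differ-≤1 a c) (differ-≤1 b c)

misses-≤1 : ∀ {m} (t : Fin m × Fin m) c → Carries t c → misses t c ≤ 1
misses-≤1 (a , b) .a (inj₁ refl) = +-mono-≤ (≤-reflexive (differ-self a)) (differ-≤1 b a)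
misses-≤1 (a , b) .b (inj₂ refl) = +-mono-≤ (differ-≤1 a b) (≤-reflexive (differ-self b))

least : ∀ {P : ℕ → Set} → (∀ k → Dec (P k)) → (∀ {k} → P k → P (suc k)) →
        ∀ {k} → P k → Σ ℕ λ m → P m × (∀ {j} → P j → m ≤ j)
least {P} P? P-suc {zero}  p = 0 , p , λ _ → z≤n
least {P} P? P-suc {suc k} p with P? k
... | yes pk = least P? P-suc pk
... | no ¬pk = suc k , p , λ pj → ≰⇒> (λ j≤k → ¬pk (upward (≤⇒≤′ j≤k) pj))
  where
  upward : ∀ {i j} → i ≤′ j → P i → P j
  upward ≤′-refl       pi = pi
  upward (≤′-step i≤j) pi = P-suc (upward i≤j pi)

EdgeOf : ∀ {n} {G : Graph n} {a b k} → Walk G a b k → Fin n → Fin n → Set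
EdgeOf here                 y x = ⊥
EdgeOf (step {u} {v} _ w) y x = (y ≡ u × x ≡ v) ⊎ EdgeOf w y x

edgeOf? : ∀ {n} {G : Graph n} {a b k} (w : Walk G a b k) → Decidable (EdgeOf w)
edgeOf? here                 y x = no λ ()
edgeOf? (step {u} {v} _ w) y x = ((y Fin.≟ u) ×-dec (x Fin.≟ v)) ⊎-dec edgeOf? w y x

edgeOf⇒Adj : ∀ {n} {G : Graph n} {a b k} (w : Walk G a b k) {y x} → EdgeOf w y x → Adj G y x
edgeOf⇒Adj (step e w) (inj₁ (refl , refl)) = e
edgeOf⇒Adj (step e w) (inj₂ yx∈w)          = edgeOf⇒Adj w yx∈w

snoc : ∀ {n} {G : Graph n} {a b c k} → Walk G a b k → Adj G b c → Walk G a c (suc k)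
snoc here       e = step e here
snoc (step e w) f = step e (snoc w f)

module Layers {n} (G : Graph n) {K : Fin n → Fin n → Set} (K? : Decidable K)
              (K⇒Adj : ∀ {y x} → K y x → Adj G y x) (r : Fin n) where

  Within : ℕ → Fin n → Set
  Within zero    x = x ≡ r
  Within (suc k) x = Within k x ⊎ ∃ λ y → Within k y × K y x

  within? : ∀ k x → Dec (Within k x)
  within? zero    x = x Fin.≟ r
  within? (suc k) x = within? k x ⊎-dec any? λ y → within? k y ×-dec K? y x

  within-walk : ∀ {a b k} (w : Walk G a b k) → (∀ {y x} → EdgeOf w y x → K y x) →
                ∀ {j} → Within j a → Within (j + k) b
  within-walk {b = b} here _ {j} a∈ = subst (λ m → Within m b) (sym (+-identityʳ j)) a∈
  within-walk {b = b} (step {u} {v} _ w) w⊆K {j} a∈ =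
    subst (λ m → Within m b) (sym (+-suc j _))
      (within-walk w (w⊆K ∘ inj₂) (inj₂ (u , a∈ , w⊆K (inj₁ (refl , refl)))))

  module Distance (reachable : ∀ x → ∃ λ k → Within k x) where

    private
      shortest : ∀ x → Σ ℕ λ m → Within m x × (∀ {j} → Within j x → m ≤ j)
      shortest x = least (λ k → within? k x) inj₁ (proj₂ (reachable x))

    layer : Fin n → ℕ
    layer x = proj₁ (shortest x)

    layer-within : ∀ x → Within (layer x) x
    layer-within x = proj₁ (proj₂ (shortest x))

    layer-least : ∀ x {j} → Within j x → layer x ≤ j
    layer-least x = proj₂ (proj₂ (shortest x))

    layer≡0 : ∀ {x} → layer x ≡ 0 → x ≡ r
    layer≡0 {x} e = subst (λ m → Within m x) e (layer-within x)

    layer-root : layer r ≡ 0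
    layer-root = n≤0⇒n≡0 (layer-least r refl)

    layer-step : ∀ {y x} → K y x → layer x ≤ suc (layer y)
    layer-step {y} {x} yx = layer-least x (inj₂ (y , layer-within y , yx))

    layer-parent : ∀ {x k} → layer x ≡ suc k → ∃ λ y → K y x × layer y ≡ k
    layer-parent {x} {k} e with subst (λ m → Within m x) e (layer-within x)
    ... | inj₁ x∈ = ⊥-elim (<-irrefl refl (subst (_≤ k) e (layer-least x x∈)))
    ... | inj₂ (y , y∈ , yx) =
      y , yx , ≤-antisym (layer-least y y∈) (≤-pred (subst (_≤ suc (layer y)) e (layer-step yx)))

    walk-to : ∀ {x k} → layer x ≡ k → Walk G r x k
    walk-to {x} {zero}  e = subst (λ z → Walk G r z 0) (sym (layer≡0 e)) here
    walk-to {x} {suc k} e with layer-parent e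
    ... | y , yx , e′ = snoc (walk-to e′) (K⇒Adj yx)

    layer-below : ∀ {x j k} → layer x ≡ k → j ≤ k → ∃ λ y → layer y ≡ j
    layer-below {x} {j} {k} e j≤k with j ≟ k
    ... | yes refl = x , e
    layer-below {k = zero}  e z≤n   | no 0≢0   = ⊥-elim (0≢0 refl)
    layer-below {k = suc k} e j≤1+k | no j≢1+k with layer-parent e
    ... | y , _ , e′ = layer-below e′ (≤-pred (≤∧≢⇒< j≤1+k j≢1+k))

module Charging {n δ} (G : Graph n) (connected : Connected G) (mindeg : MinDegGe G δ)
                (col : Fin n → Fin 3) (proper : ∀ {u v} → Adj G u v → col u ≢ col v) (r : Fin n) where

  nb : Fin n → Fin δ → Fin n
  nb x = proj₁ (mindeg x)

  -- Adj need not be decidable, so layers are taken in the decidable subgraph formed by the edges to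
  -- the listed neighbours and the edges of one chosen walk from r to each vertex.
  Kept : Fin n → Fin n → Set
  Kept y x = (∃ λ i → x ≡ nb y i) ⊎ (∃ λ i → y ≡ nb x i)
           ⊎ (∃ λ z → EdgeOf (proj₂ (connected r z)) y x)

  kept? : Decidable Kept
  kept? y x = any? (λ i → x Fin.≟ nb y i) ⊎-dec any? (λ i → y Fin.≟ nb x i)
              ⊎-dec any? (λ z → edgeOf? (proj₂ (connected r z)) y x)

  kept⇒Adj : ∀ {y x} → Kept y x → Adj G y x
  kept⇒Adj {y}     (inj₁ (i , refl))        = proj₂ (proj₂ (mindeg y)) i
  kept⇒Adj {x = x} (inj₂ (inj₁ (i , refl))) = Graph.sym G (proj₂ (proj₂ (mindeg x)) i)
  kept⇒Adj         (inj₂ (inj₂ (z , yx∈w))) = edgeOf⇒Adj (proj₂ (connected r z)) yx∈w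

  open Layers G kept? kept⇒Adj r

  reachable : ∀ x → ∃ λ k → Within k x
  reachable x = _ , within-walk (proj₂ (connected r x)) (λ yx∈w → inj₂ (inj₂ (x , yx∈w))) refl

  open Distance reachable public

  near-neighbour : ∀ x i → 1 ≤ near (layer x) (layer (nb x i))
  near-neighbour x i = near-positive (layer-step (inj₁ (i , refl))) (layer-step (inj₂ (inj₁ (i , refl))))

  occupied? : ∀ j c → Dec (∃ λ x → layer x ≡ j × col x ≡ c)
  occupied? j c = any? λ x → (layer x ≟ j) ×-dec (col x Fin.≟ c)

  present : ℕ → Subset 3
  present j = tabulate λ c → does (occupied? j c)

  present⁺ : ∀ {x j} → layer x ≡ j → col x ∈ present j
  present⁺ {x} {j} e = lookup⇒[]= (col x) (present j)
    (trans (lookup∘tabulate (does ∘ occupied? j) (col x))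
           (dec-true (occupied? j (col x)) (x , e , refl)))

  present⁻ : ∀ {c j} → c ∈ present j → ∃ λ x → layer x ≡ j × col x ≡ c
  present⁻ {c} {j} c∈
    with occupied? j c | trans (sym (lookup∘tabulate (does ∘ occupied? j) c)) ([]=⇒lookup c∈)
  ... | yes w | _  = w
  ... | no _  | ()

  tokens : ℕ → Fin 3 × Fin 3
  tokens zero    = col r , col r
  tokens (suc j) = next (proj₁ (tokens j)) (present (suc j))

  tokens-present : ∀ {x j c} → layer x ≡ j → Carries (tokens j) c → c ∈ present j
  tokens-present {j = zero}  e (inj₁ refl) = present⁺ layer-root
  tokens-present {j = zero}  e (inj₂ refl) = present⁺ layer-root
  tokens-present {x} {suc j} e (inj₁ refl) = proj₁ (next-⊆ _ _ (col x , present⁺ e))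
  tokens-present {x} {suc j} e (inj₂ refl) = proj₂ (next-⊆ _ _ (col x , present⁺ e))

  colour-covered : ∀ {y k} → layer y ≡ k →
                   Carries (tokens k) (col y) ⊎ Carries (tokens (k ∸ 1)) (col y)
  colour-covered {k = zero}  e = inj₁ (inj₁ (cong col (layer≡0 e)))
  colour-covered {y} {suc k} e = swap (map₁ inj₁ (next-covers _ _ (col y) (present⁺ e)))

  tokenCharge : ℕ → Fin 3 → Fin n → ℕ
  tokenCharge j c y = near j (layer y) * differ c (col y)

  charge : ℕ → Fin n → ℕ
  charge j y = near j (layer y) * misses (tokens j) (col y)

  charge-split : ∀ j y →
                 charge j y ≡ tokenCharge j (proj₁ (tokens j)) y + tokenCharge j (proj₂ (tokens j)) y
  charge-split j y = *-distribˡ-+ (near j (layer y)) _ _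

  ∑tokenCharge≥δ : ∀ {j c} → c ∈ present j → δ ≤ ∑[ y < n ] tokenCharge j c y
  ∑tokenCharge≥δ c∈ with present⁻ c∈
  ... | x , refl , refl = ∑-injection _ (nb x) (λ {i} {i′} → proj₁ (proj₂ (mindeg x)) i i′) λ i →
    *-mono-≤ (near-neighbour x i) (≤-reflexive (sym (differ-≢ (proper (proj₂ (proj₂ (mindeg x)) i)))))

  layer-charge : ∀ {x j} → layer x ≡ j → 2 * δ ≤ ∑[ y < n ] charge j y
  layer-charge {x} {j} e = begin
    2 * δ
      ≡⟨ cong (δ +_) (+-identityʳ δ) ⟩
    δ + δ
      ≤⟨ +-mono-≤ (∑tokenCharge≥δ (tokens-present e (inj₁ refl)))
                  (∑tokenCharge≥δ (tokens-present e (inj₂ refl))) ⟩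
    ∑[ y < n ] tokenCharge j a y + ∑[ y < n ] tokenCharge j b y
      ≡⟨ sym (∑-distrib-+ {n} (tokenCharge j a) (tokenCharge j b)) ⟩
    ∑[ y < n ] (tokenCharge j a y + tokenCharge j b y)
      ≡⟨ sym (sum-cong-≗ {n} {charge j} (charge-split j)) ⟩
    ∑[ y < n ] charge j y
      ∎
    where
    open ≤-Reasoning
    a = proj₁ (tokens j)
    b = proj₂ (tokens j)

  vertex-charge : ∀ N y → ∑[ j < N ] charge (toℕ j) y ≤ 5
  vertex-charge N y =
    ≤-trans (∑-near N (layer y) (λ j → misses (tokens j) (col y))) (window (colour-covered refl))
    where
    k = layer y
    u≤2 : ∀ j → misses (tokens j) (col y) ≤ 2
    u≤2 j = misses-≤2 (tokens j) (col y)
    u≤1 : ∀ j → Carries (tokens j) (col y) → misses (tokens j) (col y) ≤ 1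
    u≤1 j = misses-≤1 (tokens j) (col y)
    window : Carries (tokens k) (col y) ⊎ Carries (tokens (k ∸ 1)) (col y) →
             misses (tokens (k ∸ 1)) (col y) + misses (tokens k) (col y) + misses (tokens (suc k)) (col y) ≤ 5
    window (inj₁ c∈tₖ)   = +-mono-≤ (+-mono-≤ (u≤2 (k ∸ 1)) (u≤1 k c∈tₖ)) (u≤2 (suc k))
    window (inj₂ c∈tₖ₋₁) = +-mono-≤ (+-mono-≤ (u≤1 (k ∸ 1) c∈tₖ₋₁) (u≤2 k)) (u≤2 (suc k))

  charge-balance : ∀ N → (∀ {j} → j < N → ∃ λ x → layer x ≡ j) → N * (2 * δ) ≤ n * 5
  charge-balance N occupied = begin
    N * (2 * δ)
      ≡⟨ sym (∑-const N (2 * δ)) ⟩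
    ∑[ j < N ] (2 * δ)
      ≤⟨ ∑-mono-≤ {N} {λ _ → 2 * δ} (λ j → layer-charge (proj₂ (occupied (toℕ<n j)))) ⟩
    ∑[ j < N ] ∑[ y < n ] charge (toℕ j) y
      ≡⟨ ∑-comm {N} {n} (λ j y → charge (toℕ j) y) ⟩
    ∑[ y < n ] ∑[ j < N ] charge (toℕ j) y
      ≤⟨ ∑-mono-≤ {n} {λ y → ∑[ j < N ] charge (toℕ j) y} (vertex-charge N) ⟩
    ∑[ y < n ] 5
      ≡⟨ ∑-const n 5 ⟩
    n * 5
      ∎
    where open ≤-Reasoning

  eccentricity-bound : ∀ v → suc (layer v) * (2 * δ) ≤ n * 5
  eccentricity-bound v = charge-balance (suc (layer v)) (λ j≤layer → layer-below refl (≤-pred j≤layer))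

m*n≤o⇒m≤o/n : ∀ {m o} n .{{_ : NonZero n}} → m * n ≤ o → m ≤ o / n
m*n≤o⇒m≤o/n {m} n m*n≤o = subst (_≤ _) (m*n/n≡m m n) (/-monoˡ-≤ n m*n≤o)

n*[m/n]≤m : ∀ m n .{{_ : NonZero n}} → n * (m / n) ≤ m
n*[m/n]≤m m n = ≤-trans (≤-reflexive (*-comm n (m / n))) (m/n*n≤m m n)

short-walk : ∀ {n δ} {G : Graph n} → Connected G → ThreeColorable G → MinDegGe G δ →
             ∀ u v → Σ ℕ λ k → suc k * (2 * δ) ≤ 5 * n × Walk G u v k
short-walk {n} {G = G} connected (col , proper) mindeg u v =
  layer v , ≤-trans (eccentricity-bound v) (≤-reflexive (*-comm n 5)) , walk-to refl
  where open Charging G connected mindeg col proper u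

diameter-bound : ∀ {n δ} {G : Graph n} → Connected G → ThreeColorable G → MinDegGe G (suc δ) →
                 DiamLe G (5 * n / (2 * suc δ))
diameter-bound {δ = δ} connected colourable mindeg u v =
  k , m*n≤o⇒m≤o/n (2 * suc δ) (≤-trans (m≤n+m (k * (2 * suc δ)) (2 * suc δ)) bound) , walk
  where
  k = proj₁ (short-walk connected colourable mindeg u v)
  bound = proj₁ (proj₂ (short-walk connected colourable mindeg u v))
  walk = proj₂ (proj₂ (short-walk connected colourable mindeg u v))

corollary5p2 : Σ ℕ λ C → ∀ (n δ : ℕ) (G : Graph n) → 1 ≤ δ → Connected G → ThreeColorable G → MinDegGe G δ →
    Σ ℕ λ d → DiamLe G d × (2 * δ * d ≤ 5 * n + 2 * δ * C)
corollary5p2 = 0 , λ where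
  n (suc δ) G _ connected colourable mindeg →
    5 * n / (2 * suc δ) , diameter-bound connected colourable mindeg ,
    ≤-trans (n*[m/n]≤m (5 * n) (2 * suc δ)) (m≤m+n (5 * n) (2 * suc δ * 0))
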